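{- Let $\mathcal{X},\mathcal{Y}$ be finite sets, $f:\mathcal{X}\times\mathcal{Y}\to\{0,1\}$, $n\ge 1$ an integer, and $k\ge 0$ a real number. If $f^{\oplus n}$ has a monochromatic rectangle of size $2^k$, then $f$ has a monochromatic rectangle of size at least $2^{k/n-2}$.
   Context: All logarithms are base $2$. $f^{\oplus n}:\mathcal{X}^n\times\mathcal{Y}^n\to\{0,1\}$ is defined by $f^{\oplus n}(x_1,\dots,x_n,y_1,\dots,y_n)=f(x_1,y_1)\oplus\cdots\oplus f(x_n,y_n)$, viewed as a function of $(x_1,\dots,x_n)\in\mathcal{X}^n$ and $(y_1,\dots,y_n)\in\mathcal{Y}^n$. A monochromatic rectangle of $g:\mathcal{A}\times\mathcal{B}\to\{0,1\}$ is a set $A\times B$ with $A\subseteq\mathcal{A}$, $B\subseteq\mathcal{B}$ on which $g$ is constant; its size is $|A|\cdot|B|$. -}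

module Defs where

open import Data.Nat using (ℕ; _*_)
open import Data.Bool using (Bool; false; _xor_)
open import Data.Fin using (Fin)
open import Data.Vec using (Vec; foldr′; zipWith)
open import Data.List using (List; length)
open import Data.List.Relation.Unary.All using (All)
open import Data.List.Relation.Unary.Unique.Propositional using (Unique)
open import Data.Product using (Σ; _×_; ∃)
open import Relation.Binary.PropositionalEquality using (_≡_)

-- Booleans play the role of {0,1}; xor is addition mod 2.
-- f^{⊕n}(x₁..xₙ, y₁..yₙ) = f(x₁,y₁) ⊕ ... ⊕ f(xₙ,yₙ)
xorPow : {X Y : Set} → (n : ℕ) → (X → Y → Bool) → Vec X n → Vec Y n → Bool
xorPow n f xs ys = foldr′ _xor_ false (zipWith f xs ys)

-- g has a monochromatic rectangle A × B of size exactly s.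
-- Subsets are represented as duplicate-free lists, so |A| = length.
HasMonoRectOfSize : {A B : Set} → (A → B → Bool) → ℕ → Set
HasMonoRectOfSize {A} {B} g s =
  Σ (List A) λ as → Σ (List B) λ bs →
    Unique as × Unique bs × (length as * length bs ≡ s) ×
    ∃ λ (c : Bool) → All (λ x → All (λ y → g x y ≡ c) bs) as

{-# OPTIONS --safe #-}
-- Let A × B ⊆ (X₁ × X₂) × (Y₁ × Y₂) be a monochromatic rectangle of f ⊕ g.  By pigeonhole some
-- x₂ has at least |A| / |π₂ A| partners x₁ with (x₁ , x₂) ∈ A.  As f x₁ y₁ xor g x₂ y₂ is
-- constant on the rectangle, these rows of f agree on every column y₁ ∈ π₁ B, so the majority
-- colour of one of them gives a monochromatic rectangle of f of size at least
-- (|A| / |π₂ A|) · |π₁ B| / 2.  Symmetrically g has one of size at least (|B| / |π₁ B|) · |π₂ A| / 2,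
-- and the two sizes multiply to at least |A| · |B| / 4.  Since f^{⊕(m+1)} = f ⊕ f^{⊕m},
-- induction on n, keeping the larger of the two rectangles of f at each step, gives s ≤ (4 S)^n.
module Submission where

open import Defs
open import Algebra.Bundles using (CommutativeRing)
open import Data.Bool using (Bool; true; false; _xor_)
open import Data.Bool.Properties using (xor-comm; xor-∧-commutativeRing) renaming (_≟_ to _≟𝔹_)
open import Data.Empty using (⊥-elim)
open import Data.Fin using (Fin) renaming (_≟_ to _≟Fin_)
open import Data.List using (List; []; _∷_; length; map; filter; deduplicate)
open import Data.List.Properties using (length-map; map-∘; map-id-local)
open import Data.List.Membership.Propositional using (_∈_)
open import Data.List.Membership.Propositional.Properties
  using (∈-map⁺; ∈-map⁻; ∈-filter⁻; ∈-deduplicate⁺; ∈-deduplicate⁻)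
open import Data.List.Relation.Binary.Sublist.Propositional.Properties
  using (filter-⊆; filter⁺; length-mono-≤)
open import Data.List.Relation.Unary.All as All using (All; []; _∷_)
open import Data.List.Relation.Unary.All.Properties using (all-filter)
open import Data.List.Relation.Unary.AllPairs using ([]; _∷_)
open import Data.List.Relation.Unary.Any as Any using (here; there)
open import Data.List.Relation.Unary.Unique.Propositional using (Unique)
import Data.List.Relation.Unary.Unique.Propositional.Properties as Unique
open import Data.List.Relation.Unary.Unique.DecPropositional.Properties using (deduplicate-!)
open import Data.Nat using (ℕ; zero; suc; _+_; _*_; _^_; _≤_; z≤n; s≤s)
open import Data.Nat.Properties
open import Data.Nat.Tactic.RingSolver using (solve-∀)
open import Data.Product using (Σ; ∃; _×_; _,_; proj₁; proj₂; swap)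
open import Data.Sum using (_⊎_; inj₁; inj₂)
open import Data.Vec using (Vec; []; _∷_; uncons)
open import Data.Vec.Properties using (≡-dec)
open import Function using (_∘_; flip; id)
open import Function.Definitions using (Injective)
open import Level using (0ℓ)
open import Relation.Binary.Definitions using (DecidableEquality)
open import Relation.Binary.PropositionalEquality
open import Relation.Nullary using (yes; no)
open import Relation.Nullary.Decidable using (¬?)
open import Relation.Nullary.Irrelevant using (Irrelevant)
open import Relation.Unary using (Pred; Decidable)
open import Algebra.Properties.CommutativeSemigroup *-commutativeSemigroup using (x∙yz≈y∙xz)
open import Algebra.Properties.Group (CommutativeRing.+-group xor-∧-commutativeRing)
  using () renaming (∙-cancelʳ to xor-cancelʳ)

private
  variable
    A B A′ B′ X₁ X₂ Y₁ Y₂ : Set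

length-filter-split : {P : Pred A 0ℓ} (P? : Decidable P) (xs : List A) →
  length xs ≡ length (filter P? xs) + length (filter (¬? ∘ P?) xs)
length-filter-split P? [] = refl
length-filter-split P? (x ∷ xs) with P? x
... | yes _ = cong suc (length-filter-split P? xs)
... | no  _ = trans (cong suc (length-filter-split P? xs)) (sym (+-suc _ _))

Unique⇒length≤1 : Irrelevant A → {xs : List A} → Unique xs → length xs ≤ 1
Unique⇒length≤1 irr {[]}        _                 = z≤n
Unique⇒length≤1 irr {_ ∷ []}    _                 = s≤s z≤n
Unique⇒length≤1 irr {x ∷ y ∷ _} ((x≢y ∷ _) ∷ _) = ⊥-elim (x≢y (irr x y))

module Fibres {P K : Set} (_≟_ : DecidableEquality K) (key : P → K) where

  fibre : K → List P → List P
  fibre κ = filter (λ p → key p ≟ κ)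

  length-fibre-filter : ∀ {Q : Pred P 0ℓ} (Q? : Decidable Q) κ (xs : List P) →
    length (fibre κ (filter Q? xs)) ≤ length (fibre κ xs)
  length-fibre-filter Q? κ xs = length-mono-≤ (filter⁺ _ _ (λ { refl → id }) (filter-⊆ Q? xs))

  pigeonhole : (κs : List K) (xs : List P) → All (λ p → key p ∈ κs) xs →
    xs ≡ [] ⊎ ∃ λ κ → length xs ≤ length κs * length (fibre κ xs)
  pigeonhole []        []      _        = inj₁ refl
  pigeonhole []        (_ ∷ _) (() ∷ _)
  pigeonhole (κ₀ ∷ κs) xs      keys     = inj₂ (largerFibre (restBound (pigeonhole κs rest keys-rest)))
    where
      rest = filter (λ p → ¬? (key p ≟ κ₀)) xs

      keys-rest : All (λ p → key p ∈ κs) rest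
      keys-rest = All.tabulate λ p∈ → let (p∈xs , key≢κ₀) = ∈-filter⁻ _ p∈
                                       in Any.tail key≢κ₀ (All.lookup keys p∈xs)

      RestBound = ∃ λ κ → length rest ≤ length κs * length (fibre κ xs)

      restBound : rest ≡ [] ⊎ ∃ (λ κ → length rest ≤ length κs * length (fibre κ rest)) → RestBound
      restBound (inj₁ rest≡[])    =
        κ₀ , subst (λ ys → length ys ≤ length κs * length (fibre κ₀ xs)) (sym rest≡[]) z≤n
      restBound (inj₂ (κ , bound)) =
        κ , ≤-trans bound (*-monoʳ-≤ (length κs) (length-fibre-filter _ κ xs))

      largerFibre : RestBound → ∃ λ κ → length xs ≤ length (κ₀ ∷ κs) * length (fibre κ xs)
      largerFibre (κ , bound) = pick (≤-total a b)
        where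
          a = length (fibre κ₀ xs)
          b = length (fibre κ xs)

          xs≤ : length xs ≤ a + length κs * b
          xs≤ = subst (_≤ a + length κs * b) (sym (length-filter-split _ xs)) (+-monoʳ-≤ a bound)

          pick : a ≤ b ⊎ b ≤ a → ∃ λ κ′ → length xs ≤ length (κ₀ ∷ κs) * length (fibre κ′ xs)
          pick (inj₁ a≤b) = κ  , ≤-trans xs≤ (+-monoˡ-≤ _ a≤b)
          pick (inj₂ b≤a) = κ₀ , ≤-trans xs≤ (+-monoʳ-≤ a (*-monoʳ-≤ (length κs) b≤a))

record MonoRect (g : A → B → Bool) : Set where
  field
    rows        : List A
    cols        : List B
    rows-unique : Unique rows
    cols-unique : Unique cols
    colour      : Bool
    mono        : ∀ {x y} → x ∈ rows → y ∈ cols → g x y ≡ colour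

  size : ℕ
  size = length rows * length cols

open MonoRect

module _ {g : A → B → Bool} where

  fromHasMonoRectOfSize : ∀ {s} → HasMonoRectOfSize g s → Σ (MonoRect g) λ R → size R ≡ s
  fromHasMonoRectOfSize (xs , ys , uxs , uys , size≡s , c , g≡c) =
    record { rows = xs ; cols = ys ; rows-unique = uxs ; cols-unique = uys ; colour = c
           ; mono = λ x∈ y∈ → All.lookup (All.lookup g≡c x∈) y∈ } , size≡s

  toHasMonoRectOfSize : (R : MonoRect g) → HasMonoRectOfSize g (size R)
  toHasMonoRectOfSize R = rows R , cols R , rows-unique R , cols-unique R , refl , colour R ,
    All.tabulate λ x∈ → All.tabulate λ y∈ → mono R x∈ y∈

  emptyRect : MonoRect g
  emptyRect = record { rows = [] ; cols = [] ; rows-unique = [] ; cols-unique = [] ; colour = false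
                     ; mono = λ () }

  transpose : MonoRect g → MonoRect (flip g)
  transpose R = record { rows = cols R ; cols = rows R ; rows-unique = cols-unique R
                       ; cols-unique = rows-unique R ; colour = colour R ; mono = flip (mono R) }

  size-transpose : (R : MonoRect g) → size (transpose R) ≡ size R
  size-transpose R = *-comm (length (cols R)) (length (rows R))

  largerRect : (R R′ : MonoRect g) → Σ (MonoRect g) λ M → size R ≤ size M × size R′ ≤ size M
  largerRect R R′ with ≤-total (size R) (size R′)
  ... | inj₁ R≤R′ = R′ , R≤R′ , ≤-refl
  ... | inj₂ R′≤R = R  , ≤-refl , R′≤R

  size≤1 : Irrelevant A → Irrelevant B → (R : MonoRect g) → size R ≤ 1
  size≤1 irrA irrB R =
    *-mono-≤ (Unique⇒length≤1 irrA (rows-unique R)) (Unique⇒length≤1 irrB (cols-unique R))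

module _ {g : A → B → Bool} {h : A′ → B′ → Bool} (φ : A → A′) (ψ : B → B′)
         (φ-injective : Injective _≡_ _≡_ φ) (ψ-injective : Injective _≡_ _≡_ ψ)
         (h∘φψ≡g : ∀ x y → h (φ x) (ψ y) ≡ g x y) where

  mapRect : MonoRect g → MonoRect h
  mapRect R = record
    { rows = map φ (rows R) ; cols = map ψ (cols R)
    ; rows-unique = Unique.map⁺ φ-injective (rows-unique R)
    ; cols-unique = Unique.map⁺ ψ-injective (cols-unique R)
    ; colour = colour R
    ; mono = λ x∈ y∈ → mono′ (∈-map⁻ φ x∈) (∈-map⁻ ψ y∈) }
    where
      mono′ : ∀ {x′ y′} → ∃ (λ x → x ∈ rows R × x′ ≡ φ x) → ∃ (λ y → y ∈ cols R × y′ ≡ ψ y) →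
        h x′ y′ ≡ colour R
      mono′ (x , x∈ , refl) (y , y∈ , refl) = trans (h∘φψ≡g x y) (mono R x∈ y∈)

  size-mapRect : (R : MonoRect g) → size (mapRect R) ≡ size R
  size-mapRect R = cong₂ _*_ (length-map φ (rows R)) (length-map ψ (cols R))

∈-true∷false : ∀ b → b ∈ true ∷ false ∷ []
∈-true∷false true  = here refl
∈-true∷false false = there (here refl)

majorityColour : (c : A → Bool) (xs : List A) →
  ∃ λ b → length xs ≤ 2 * length (Fibres.fibre _≟𝔹_ c b xs)
majorityColour c xs
  with Fibres.pigeonhole _≟𝔹_ c (true ∷ false ∷ []) xs (All.tabulate (λ {x} _ → ∈-true∷false (c x)))
... | inj₁ refl  = false , z≤n
... | inj₂ bound = bound

agreeingRowsRect : (f : A → B → Bool) (xs : List A) (ys : List B) → Unique xs → Unique ys →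
  (∀ {x x′ y} → x ∈ xs → x′ ∈ xs → y ∈ ys → f x y ≡ f x′ y) →
  Σ (MonoRect f) λ R → length xs * length ys ≤ 2 * size R
agreeingRowsRect f []            ys _   _   _     = emptyRect , z≤n
agreeingRowsRect f xs@(x₀ ∷ _) ys uxs uys agree = rect , bound
  where
    open Fibres _≟𝔹_ (f x₀)
    b = proj₁ (majorityColour (f x₀) ys)

    rect : MonoRect f
    rect = record
      { rows = xs ; cols = fibre b ys ; rows-unique = uxs ; cols-unique = Unique.filter⁺ _ uys
      ; colour = b
      ; mono = λ x∈ y∈ → let (y∈ys , f-x₀-y≡b) = ∈-filter⁻ _ y∈
                         in trans (agree x∈ (here refl) y∈ys) f-x₀-y≡b }

    bound : length xs * length ys ≤ 2 * (length xs * length (fibre b ys))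
    bound = begin
      length xs * length ys               ≤⟨ *-monoʳ-≤ (length xs) (proj₂ (majorityColour (f x₀) ys)) ⟩
      length xs * (2 * length (fibre b ys)) ≡⟨ x∙yz≈y∙xz (length xs) 2 (length (fibre b ys)) ⟩
      2 * (length xs * length (fibre b ys)) ∎
      where open ≤-Reasoning

module _ {A B : Set} where

  dom : DecidableEquality A → List (A × B) → List A
  dom _≟_ ps = deduplicate _≟_ (map proj₁ ps)

  cod : DecidableEquality B → List (A × B) → List B
  cod _≟_ ps = deduplicate _≟_ (map proj₂ ps)

  section : DecidableEquality B → B → List (A × B) → List A
  section _≟_ y ps = map proj₁ (Fibres.fibre _≟_ proj₂ y ps)

  length-section : (_≟_ : DecidableEquality B) (y : B) (ps : List (A × B)) →
    length (section _≟_ y ps) ≡ length (Fibres.fibre _≟_ proj₂ y ps)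
  length-section _≟_ y ps = length-map proj₁ (Fibres.fibre _≟_ proj₂ y ps)

  ∈-dom⁻ : (_≟_ : DecidableEquality A) {ps : List (A × B)} {x : A} →
    x ∈ dom _≟_ ps → ∃ λ y → (x , y) ∈ ps
  ∈-dom⁻ _≟_ {ps} x∈ with ∈-map⁻ proj₁ (∈-deduplicate⁻ _≟_ (map proj₁ ps) x∈)
  ... | (x , y) , xy∈ , refl = y , xy∈

  ∈-cod⁺ : (_≟_ : DecidableEquality B) {ps : List (A × B)} {p : A × B} → p ∈ ps → proj₂ p ∈ cod _≟_ ps
  ∈-cod⁺ _≟_ p∈ = ∈-deduplicate⁺ _≟_ (∈-map⁺ proj₂ p∈)

  ∈-section⁻ : (_≟_ : DecidableEquality B) {y : B} {ps : List (A × B)} {x : A} →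
    x ∈ section _≟_ y ps → (x , y) ∈ ps
  ∈-section⁻ _≟_ {y} x∈ with ∈-map⁻ proj₁ x∈
  ... | p , p∈ , refl with ∈-filter⁻ (λ q → proj₂ q ≟ y) p∈
  ...   | p∈ps , refl = p∈ps

  section-unique : (_≟_ : DecidableEquality B) {y : B} {ps : List (A × B)} →
    Unique ps → Unique (section _≟_ y ps)
  section-unique _≟_ {y} {ps} ups = Unique.map⁻ (subst Unique (sym pairs≡fibre) (Unique.filter⁺ _ ups))
    where
      pairs≡fibre : map (_, y) (section _≟_ y ps) ≡ Fibres.fibre _≟_ proj₂ y ps
      pairs≡fibre = trans (sym (map-∘ _))
        (map-id-local (All.map (λ {p} p₂≡y → cong (proj₁ p ,_) (sym p₂≡y)) (all-filter _ ps)))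

cod-map-swap : (_≟_ : DecidableEquality A) (ps : List (A × B)) → cod _≟_ (map swap ps) ≡ dom _≟_ ps
cod-map-swap _≟_ ps = cong (deduplicate _≟_) (sym (map-∘ ps))

dom-map-swap : (_≟_ : DecidableEquality B) (ps : List (A × B)) → dom _≟_ (map swap ps) ≡ cod _≟_ ps
dom-map-swap _≟_ ps = cong (deduplicate _≟_) (sym (map-∘ ps))

_⊕_ : (X₁ → Y₁ → Bool) → (X₂ → Y₂ → Bool) → X₁ × X₂ → Y₁ × Y₂ → Bool
(f ⊕ g) (x₁ , x₂) (y₁ , y₂) = f x₁ y₁ xor g x₂ y₂

swapRect : {f : X₁ → Y₁ → Bool} {g : X₂ → Y₂ → Bool} → MonoRect (f ⊕ g) → MonoRect (flip g ⊕ flip f)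
swapRect {f = f} {g} R =
  mapRect swap swap (cong swap) (cong swap) (λ _ _ → xor-comm (g _ _) (f _ _)) (transpose R)

factor-bound : ∀ {a b} k r c r′ s t → a ≤ k * r → r * c ≤ 2 * s → b ≤ c * r′ → r′ * k ≤ 2 * t →
  a * b ≤ 4 * s * t
factor-bound {a} {b} k r c r′ s t a≤ s≥ b≤ t≥ = begin
  a * b                 ≤⟨ *-mono-≤ a≤ b≤ ⟩
  (k * r) * (c * r′)    ≡⟨ rearrange k r c r′ ⟩
  (r * c) * (r′ * k)    ≤⟨ *-mono-≤ s≥ t≥ ⟩
  (2 * s) * (2 * t)     ≡⟨ double² s t ⟩
  4 * s * t             ∎
  where
    open ≤-Reasoning
    rearrange : ∀ k r c r′ → (k * r) * (c * r′) ≡ (r * c) * (r′ * k)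
    rearrange = solve-∀
    double² : ∀ s t → (2 * s) * (2 * t) ≡ 4 * s * t
    double² = solve-∀

module _ (_≟X₂_ : DecidableEquality X₂) (_≟Y₁_ : DecidableEquality Y₁)
         {f : X₁ → Y₁ → Bool} {g : X₂ → Y₂ → Bool} where

  leftFactorRect : (R : MonoRect (f ⊕ g)) → Σ ℕ λ r → Σ (MonoRect f) λ R₁ →
    length (rows R) ≤ length (cod _≟X₂_ (rows R)) * r × r * length (dom _≟Y₁_ (cols R)) ≤ 2 * size R₁
  leftFactorRect R
    with Fibres.pigeonhole _≟X₂_ proj₂ (cod _≟X₂_ (rows R)) (rows R) (All.tabulate (∈-cod⁺ _≟X₂_))
  ... | inj₁ rows≡[] = 0 , emptyRect , ≤-trans (≤-reflexive (cong length rows≡[])) z≤n , z≤n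
  ... | inj₂ (x₂ , bound) = length fibreRows , proj₁ rect ,
        subst (λ r → length (rows R) ≤ length (cod _≟X₂_ (rows R)) * r)
              (sym (length-section _≟X₂_ x₂ (rows R))) bound ,
        proj₂ rect
    where
      fibreRows = section _≟X₂_ x₂ (rows R)

      agree : ∀ {x x′ y₁} → x ∈ fibreRows → x′ ∈ fibreRows → y₁ ∈ dom _≟Y₁_ (cols R) →
        f x y₁ ≡ f x′ y₁
      agree x∈ x′∈ y₁∈ = let (y₂ , y∈) = ∈-dom⁻ _≟Y₁_ y₁∈ in
        xor-cancelʳ (g x₂ y₂) _ _
          (trans (mono R (∈-section⁻ _≟X₂_ x∈) y∈) (sym (mono R (∈-section⁻ _≟X₂_ x′∈) y∈)))

      rect = agreeingRowsRect f fibreRows (dom _≟Y₁_ (cols R))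
               (section-unique _≟X₂_ (rows-unique R)) (deduplicate-! _≟Y₁_ _) agree

module _ (_≟X₂_ : DecidableEquality X₂) (_≟Y₁_ : DecidableEquality Y₁)
         {f : X₁ → Y₁ → Bool} {g : X₂ → Y₂ → Bool} where

  rightFactorRect : (R : MonoRect (f ⊕ g)) → Σ ℕ λ r → Σ (MonoRect g) λ R₂ →
    length (cols R) ≤ length (dom _≟Y₁_ (cols R)) * r × r * length (cod _≟X₂_ (rows R)) ≤ 2 * size R₂
  rightFactorRect R
    with leftFactorRect _≟Y₁_ _≟X₂_ {f = flip g} {g = flip f} (swapRect {f = f} {g = g} R)
  ... | r , R₂ , cols≤ , size≥ = r , transpose R₂ ,
        subst₂ (λ m n → m ≤ n * r)
               (length-map swap (cols R)) (cong length (cod-map-swap _≟Y₁_ (cols R))) cols≤ ,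
        subst₂ (λ m n → r * m ≤ 2 * n)
               (cong length (dom-map-swap _≟X₂_ (rows R))) (sym (size-transpose R₂)) size≥

  ⊕-rect : (R : MonoRect (f ⊕ g)) →
    Σ (MonoRect f) λ R₁ → Σ (MonoRect g) λ R₂ → size R ≤ 4 * size R₁ * size R₂
  ⊕-rect R with leftFactorRect _≟X₂_ _≟Y₁_ {f = f} {g = g} R | rightFactorRect R
  ... | r , R₁ , rows≤ , size₁≥ | r′ , R₂ , cols≤ , size₂≥ =
        R₁ , R₂ , factor-bound k r c r′ (size R₁) (size R₂) rows≤ size₁≥ cols≤ size₂≥
    where
      k = length (cod _≟X₂_ (rows R))
      c = length (dom _≟Y₁_ (cols R))

uncons-injective : ∀ {n} → Injective _≡_ _≡_ (uncons {A = A} {n = n})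
uncons-injective {x = _ ∷ _} {y = _ ∷ _} refl = refl

xorPow-uncons : ∀ {f : A → B → Bool} {m} (xs : Vec A (suc m)) (ys : Vec B (suc m)) →
  (f ⊕ xorPow m f) (uncons xs) (uncons ys) ≡ xorPow (suc m) f xs ys
xorPow-uncons (_ ∷ _) (_ ∷ _) = refl

module _ {f : A → B → Bool} {m : ℕ} where

  unconsRect : MonoRect (xorPow (suc m) f) → MonoRect (f ⊕ xorPow m f)
  unconsRect = mapRect uncons uncons uncons-injective uncons-injective xorPow-uncons

  size-unconsRect : (R : MonoRect (xorPow (suc m) f)) → size (unconsRect R) ≡ size R
  size-unconsRect = size-mapRect {g = xorPow (suc m) f} {h = f ⊕ xorPow m f}
                      uncons uncons uncons-injective uncons-injective xorPow-uncons

Vec0-irrelevant : Irrelevant (Vec A 0)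
Vec0-irrelevant [] [] = refl

power-step : ∀ {s a b c d} m → s ≤ 4 * a * b → b ≤ (4 * c) ^ m → a ≤ d → c ≤ d → s ≤ (4 * d) ^ suc m
power-step m s≤ b≤ a≤d c≤d =
  ≤-trans s≤ (*-mono-≤ (*-monoʳ-≤ 4 a≤d) (≤-trans b≤ (^-monoˡ-≤ m (*-monoʳ-≤ 4 c≤d))))

module _ (_≟A_ : DecidableEquality A) (_≟B_ : DecidableEquality B) (f : A → B → Bool) where

  xorPow-rect : ∀ n (R : MonoRect (xorPow n f)) → Σ (MonoRect f) λ R₁ → size R ≤ (4 * size R₁) ^ n
  xorPow-rect zero    R = emptyRect , size≤1 Vec0-irrelevant Vec0-irrelevant R
  xorPow-rect (suc m) R =
    let (R₁ , R₂ , R≤R₁R₂) = ⊕-rect (≡-dec _≟A_) _≟B_ {f = f} {g = xorPow m f} (unconsRect R)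
        (T , R₂≤T)        = xorPow-rect m R₂
        (M , R₁≤M , T≤M)  = largerRect R₁ T
    in M , power-step m (≤-trans (≤-reflexive (sym (size-unconsRect R))) R≤R₁R₂) R₂≤T R₁≤M T≤M

theorem1p4 : (a b : ℕ) (f : Fin a → Fin b → Bool) (n : ℕ) → 1 ≤ n →
    (s : ℕ) → 1 ≤ s → HasMonoRectOfSize (xorPow n f) s →
    Σ ℕ λ S → HasMonoRectOfSize f S × (s ≤ (4 * S) ^ n)
theorem1p4 a b f n _ s _ rect with fromHasMonoRectOfSize rect
... | R , refl with xorPow-rect _≟Fin_ _≟Fin_ f n R
... | R₁ , bound = size R₁ , toHasMonoRectOfSize R₁ , bound
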